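{- Let $G$ be a framework for a $3$-connected matroid $M$ with $|E(M)|\ge 4$, and suppose $G$ has no isolated vertices. Then either (a) $G$ is connected, or (b) $G$ has exactly two components, one of which is a loop-component. Moreover, $M$ has a connected framework.
   Context: For a graph $G$ and a vertex $v$, $\mathrm{loops}_G(v)$ denotes the set of loop-edges of $G$ at $v$. Graphs are finite and may have loops and parallel edges. For a set $X$ of edges, $G[X]$ is the subgraph of $G$ with edge-set $X$ and no isolated vertices. A graph $G$ is a framework for a matroid $M$ if (1) $E(G)=E(M)$; (2) $r_M(E(H))\le |V(H)|$ for each component $H$ of $G$; (3) for each vertex $v$ of $G$, $\mathrm{cl}_M(E(G-v))\subseteq E(G-v)\cup \mathrm{loops}_G(v)$; and (4) for each circuit $C$ of $M$, the subgraph $G[C]$ has at most two components. A loop-component of a graph is a component consisting of exactly one vertex and exactly one edge. -}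

module Defs where

open import Data.Nat using (ℕ; _≤_; _+_; _<_; suc)
open import Data.Bool using (Bool; true; false; not; _∧_; _∨_)
open import Data.Fin using (Fin; _≟_)
open import Data.Fin.Subset using (Subset; _∈_; _∉_; _⊆_; _∪_; _∩_; ∁; ⁅_⁆; ∣_∣; ⊤)
open import Data.Fin.Subset.Properties using (_∈?_)
open import Data.Vec using (tabulate)
open import Data.Product using (Σ; ∃; ∃-syntax; _×_; _,_; proj₁; proj₂)
open import Data.Sum using (_⊎_)
open import Relation.Nullary using (¬_; Dec; does)
open import Relation.Binary.PropositionalEquality using (_≡_; _≢_)
open import Relation.Binary.Construct.Closure.ReflexiveTransitive using (Star)

record Matroid (m : ℕ) : Set where
  field
    r          : Subset m → ℕ
    r-bounded  : ∀ X → r X ≤ ∣ X ∣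
    r-mono     : ∀ X Y → X ⊆ Y → r X ≤ r Y
    r-submod   : ∀ X Y → r (X ∪ Y) + r (X ∩ Y) ≤ r X + r Y

module _ {m : ℕ} (M : Matroid m) where
  open Matroid M

  Independent : Subset m → Set
  Independent X = r X ≡ ∣ X ∣

  Circuit : Subset m → Set
  Circuit C = ¬ Independent C × (∀ Y → Y ⊆ C → Y ≢ C → Independent Y)

  cl : Subset m → Subset m
  cl X = tabulate (λ e → does (Data.Nat._≟_ (r (X ∪ ⁅ e ⁆)) (r X)))

  -- Tutte connectivity: M is 3-connected iff it has no k-separation
  -- for k ∈ {1,2}; a k-separation is a partition (X, E−X) with
  -- |X|, |E−X| ≥ k and r(X) + r(E−X) − r(E) ≤ k − 1.
  ThreeConnected : Set
  ThreeConnected = ∀ (X : Subset m) (k : ℕ) → 1 ≤ k → k < 3 →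
    k ≤ ∣ X ∣ → k ≤ ∣ ∁ X ∣ → r ⊤ + k ≤ r X + r (∁ X)

record Graph (m : ℕ) : Set where
  field
    n    : ℕ
    ends : Fin m → Fin n × Fin n

module _ {m : ℕ} (G : Graph m) where
  open Graph G

  Incident : Fin m → Fin n → Set
  Incident e v = proj₁ (ends e) ≡ v ⊎ proj₂ (ends e) ≡ v

  incident? : Fin m → Fin n → Bool
  incident? e v = does (proj₁ (ends e) ≟ v) ∨ does (proj₂ (ends e) ≟ v)

  IsLoopAt : Fin m → Fin n → Set
  IsLoopAt e v = proj₁ (ends e) ≡ v × proj₂ (ends e) ≡ v

  loops : Fin n → Subset m
  loops v = tabulate (λ e → does (proj₁ (ends e) ≟ v) ∧ does (proj₂ (ends e) ≟ v))

  edgesAvoiding : Fin n → Subset m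
  edgesAvoiding v = tabulate (λ e → not (incident? e v))

  AdjIn : Subset m → Fin n → Fin n → Set
  AdjIn X u w = ∃[ e ] (e ∈ X × (ends e ≡ (u , w) ⊎ ends e ≡ (w , u)))

  ConnectedIn : Subset m → Fin n → Fin n → Set
  ConnectedIn X = Star (AdjIn X)

  Connected : Fin n → Fin n → Set
  Connected = ConnectedIn ⊤

  NoIsolatedVertices : Set
  NoIsolatedVertices = ∀ v → ∃[ e ] Incident e v

  IsComponent : Subset n → Set
  IsComponent S = (∃[ v ] v ∈ S) × (∀ u w → u ∈ S → (Connected u w → w ∈ S) × (w ∈ S → Connected u w))

  edgesOf : Subset n → Subset m
  edgesOf S = tabulate (λ e → does (proj₁ (ends e) ∈? S) ∧ does (proj₂ (ends e) ∈? S))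

  IsConnected : Set
  IsConnected = ∀ u w → Connected u w

  -- G[X] has at most two components: no three vertices of G[X]
  -- (i.e. vertices incident with an edge of X) are pairwise
  -- disconnected in G[X].
  VertexOf : Subset m → Fin n → Set
  VertexOf X v = ∃[ e ] (e ∈ X × Incident e v)

  AtMostTwoComponents : Subset m → Set
  AtMostTwoComponents X = ∀ u₁ u₂ u₃ → VertexOf X u₁ → VertexOf X u₂ → VertexOf X u₃ →
    ConnectedIn X u₁ u₂ ⊎ ConnectedIn X u₁ u₃ ⊎ ConnectedIn X u₂ u₃

  -- G has exactly two components, one of which is a loop-component
  -- (a single vertex v with a single edge, a loop at v)
  TwoComponentsOneLoopComponent : Set
  TwoComponentsOneLoopComponent =
    ∃[ v ] ∃[ e ] (IsLoopAt e v × (∀ f → Incident f v → f ≡ e)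
      × (∃[ u ] u ≢ v) × (∀ u w → u ≢ v → w ≢ v → Connected u w))

-- G is a framework for M  (condition (1), E(G) = E(M), holds because
-- both have edge/ground set Fin m)
IsFramework : {m : ℕ} → Matroid m → Graph m → Set
IsFramework {m} M G =
    (∀ S → IsComponent G S → Matroid.r M (edgesOf G S) ≤ ∣ S ∣)
  × (∀ v → cl M (edgesAvoiding G v) ⊆ (edgesAvoiding G v ∪ loops G v))
  × (∀ C → Circuit M C → AtMostTwoComponents G C)

-- Grow the component S of a vertex one vertex at a time: by the closure condition (3) the edge
-- reaching a new vertex w lies outside cl(E(G - w)), so it raises the rank, whence
-- r(Y ∪ E(S)) ≥ r(Y) + |S| - 1 for every edge set Y avoiding S. With (2) this bounds
-- r(E(S)) + r(E - E(S)) by r(M) + 1, so 3-connectivity leaves at most one edge on one side.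
-- If every component had a single edge, a circuit (at least three elements) would meet three
-- components, against (4). Hence some component misses at most one edge e: either G is
-- connected or e is a loop forming a loop-component. In the latter case e is not a coloop, so
-- r(M) ≤ |V| - 1, and identifying the loop vertex with another vertex gives a connected framework.
module Submission where

open import Defs
open import Data.Nat using (ℕ; _≤_)
open import Data.Sum using (_⊎_)
open import Data.Product using (_×_; ∃-syntax)

open import Data.Nat using (zero; suc; _+_; _∸_; _<_; z≤n; s≤s; _≤?_)
import Data.Nat.Properties as ℕ
open import Data.Bool using (Bool; T)
open import Data.Bool.Properties using (T-≡)
open import Data.Fin using (Fin; zero; suc; _≟_; punchIn; punchOut)
import Data.Fin.Properties as Fin
open import Data.Fin.Subset
open import Data.Fin.Subset.Properties
open import Data.Vec using ([]; _∷_; tabulate; here; there)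
open import Data.Vec.Properties using (lookup∘tabulate; []=⇒lookup; lookup⇒[]=)
open import Data.Product using (Σ; ∃; _,_; proj₁; proj₂)
import Data.Product as Product
open import Data.Sum using (inj₁; inj₂)
open import Function using (_∘_; Equivalence)
open import Relation.Nullary using (¬_; Dec; does; yes; no; contradiction)
open import Relation.Nullary.Decidable
  using (decidable-stable; _×-dec_; _⊎-dec_; ¬?)
open import Relation.Binary.PropositionalEquality
open import Relation.Binary.Construct.Closure.ReflexiveTransitive as Star using (ε; _◅_; _◅◅_)

-- Finite subsets

∈-tabulate⁻ : ∀ {n} {f : Fin n → Bool} {i : Fin n} → i ∈ tabulate f → T (f i)
∈-tabulate⁻ {f = f} {i} i∈ = Equivalence.from T-≡ (trans (sym (lookup∘tabulate f i)) ([]=⇒lookup i∈))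

∈-tabulate⁺ : ∀ {n} {f : Fin n → Bool} {i : Fin n} → T (f i) → i ∈ tabulate f
∈-tabulate⁺ {f = f} {i} t = lookup⇒[]= i _ (trans (lookup∘tabulate f i) (Equivalence.to T-≡ t))

T-does⁻ : ∀ {a} {A : Set a} (a? : Dec A) → T (does a?) → A
T-does⁻ (yes a) _ = a

T-does⁺ : ∀ {a} {A : Set a} (a? : Dec A) → A → T (does a?)
T-does⁺ (yes _) _ = _
T-does⁺ (no ¬a) a = ¬a a

x∈p⇒1≤∣p∣ : ∀ {n} {x : Fin n} {p : Subset n} → x ∈ p → 1 ≤ ∣ p ∣
x∈p⇒1≤∣p∣ {x = x} x∈p =
  subst (_≤ _) (∣⁅x⁆∣≡1 x) (p⊆q⇒∣p∣≤∣q∣ λ y∈⁅x⁆ → subst (_∈ _) (sym (x∈⁅y⁆⇒x≡y x y∈⁅x⁆)) x∈p)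

nonempty : ∀ {n} (p : Subset n) → 1 ≤ ∣ p ∣ → Nonempty p
nonempty (inside ∷ p) _ = zero , here
nonempty (outside ∷ p) 1≤∣p∣ = Product.map suc there (nonempty p 1≤∣p∣)

x∈p─q⁻ : ∀ {n} {x : Fin n} (p q : Subset n) → x ∈ p ─ q → x ∈ p × x ∉ q
x∈p─q⁻ {x = zero} (inside ∷ p) (outside ∷ q) here = here , λ ()
x∈p─q⁻ {x = zero} (inside ∷ p) (inside ∷ q) ()
x∈p─q⁻ {x = zero} (outside ∷ p) (inside ∷ q) ()
x∈p─q⁻ {x = zero} (outside ∷ p) (outside ∷ q) ()
x∈p─q⁻ {x = suc x} (_ ∷ p) (_ ∷ q) (there x∈) = Product.map there (λ x∉q → x∉q ∘ drop-there) (x∈p─q⁻ p q x∈)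

x∈p-y⁻ : ∀ {n} {x y : Fin n} {p : Subset n} → x ∈ p - y → x ∈ p × x ≢ y
x∈p-y⁻ {y = y} {p} = Product.map₂ x∉⁅y⁆⇒x≢y ∘ x∈p─q⁻ p ⁅ y ⁆

∣p∣≡∣p∩q∣+∣p─q∣ : ∀ {n} (p q : Subset n) → ∣ p ∣ ≡ ∣ p ∩ q ∣ + ∣ p ─ q ∣
∣p∣≡∣p∩q∣+∣p─q∣ [] [] = refl
∣p∣≡∣p∩q∣+∣p─q∣ (inside ∷ p) (inside ∷ q) = cong suc (∣p∣≡∣p∩q∣+∣p─q∣ p q)
∣p∣≡∣p∩q∣+∣p─q∣ (inside ∷ p) (outside ∷ q) =
  trans (cong suc (∣p∣≡∣p∩q∣+∣p─q∣ p q)) (sym (ℕ.+-suc _ _))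
∣p∣≡∣p∩q∣+∣p─q∣ (outside ∷ p) (inside ∷ q) = ∣p∣≡∣p∩q∣+∣p─q∣ p q
∣p∣≡∣p∩q∣+∣p─q∣ (outside ∷ p) (outside ∷ q) = ∣p∣≡∣p∩q∣+∣p─q∣ p q

1+k≤∣p∣⇒k≤∣p-x∣ : ∀ {n k} (p : Subset n) (x : Fin n) → suc k ≤ ∣ p ∣ → k ≤ ∣ p - x ∣
1+k≤∣p∣⇒k≤∣p-x∣ p x 1+k≤∣p∣ = ℕ.≤-pred (begin
  suc _                      ≤⟨ 1+k≤∣p∣ ⟩
  ∣ p ∣                      ≡⟨ ∣p∣≡∣p∩q∣+∣p─q∣ p ⁅ x ⁆ ⟩
  ∣ p ∩ ⁅ x ⁆ ∣ + ∣ p - x ∣  ≤⟨ ℕ.+-monoˡ-≤ _ (subst (∣ p ∩ ⁅ x ⁆ ∣ ≤_) (∣⁅x⁆∣≡1 x) (∣p∩q∣≤∣q∣ p ⁅ x ⁆)) ⟩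
  suc ∣ p - x ∣              ∎)
  where open ℕ.≤-Reasoning

∣p∣≤1⇒x≡y : ∀ {n} {p : Subset n} {x y : Fin n} → ∣ p ∣ ≤ 1 → x ∈ p → y ∈ p → x ≡ y
∣p∣≤1⇒x≡y {p = p} {x} {y} ∣p∣≤1 x∈p y∈p with x ≟ y
... | yes x≡y = x≡y
... | no x≢y = contradiction (ℕ.≤-trans (s≤s 1≤∣p-x∣) (ℕ.≤-trans (x∈p⇒∣p-x∣<∣p∣ x∈p) ∣p∣≤1)) λ { (s≤s ()) }
  where
  1≤∣p-x∣ : 1 ≤ ∣ p - x ∣
  1≤∣p-x∣ = x∈p⇒1≤∣p∣ (x∈p∧x≢y⇒x∈p-y y∈p (x≢y ∘ sym))

∣p∪⁅x⁆∣≡1+∣p∣ : ∀ {n} (p : Subset n) (x : Fin n) → x ∉ p → ∣ p ∪ ⁅ x ⁆ ∣ ≡ suc ∣ p ∣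
∣p∪⁅x⁆∣≡1+∣p∣ (inside ∷ p) zero x∉p = contradiction here x∉p
∣p∪⁅x⁆∣≡1+∣p∣ (outside ∷ p) zero _ = cong (suc ∘ ∣_∣) (∪-identityʳ p)
∣p∪⁅x⁆∣≡1+∣p∣ (inside ∷ p) (suc x) x∉p = cong suc (∣p∪⁅x⁆∣≡1+∣p∣ p x (x∉p ∘ there))
∣p∪⁅x⁆∣≡1+∣p∣ (outside ∷ p) (suc x) x∉p = ∣p∪⁅x⁆∣≡1+∣p∣ p x (x∉p ∘ there)

x≢y⇒x∈∁⁅y⁆ : ∀ {n} {x y : Fin n} → x ≢ y → x ∈ ∁ ⁅ y ⁆
x≢y⇒x∈∁⁅y⁆ = x∉p⇒x∈∁p ∘ x≢y⇒x∉⁅y⁆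

x∈∁⁅y⁆⇒x≢y : ∀ {n} {x y : Fin n} → x ∈ ∁ ⁅ y ⁆ → x ≢ y
x∈∁⁅y⁆⇒x≢y = x∉⁅y⁆⇒x≢y ∘ x∈∁p⇒x∉p

∣∁⁅x⁆∣≡n∸1 : ∀ {n} (x : Fin n) → ∣ ∁ ⁅ x ⁆ ∣ ≡ n ∸ 1
∣∁⁅x⁆∣≡n∸1 {n} x = trans (∣∁p∣≡n∸∣p∣ ⁅ x ⁆) (cong (n ∸_) (∣⁅x⁆∣≡1 x))

three-distinct : ∀ {n} {p : Subset n} → 3 ≤ ∣ p ∣ →
  ∃[ x ] ∃[ y ] ∃[ z ] (x ∈ p × y ∈ p × z ∈ p) × (x ≢ y × x ≢ z × y ≢ z)
three-distinct {p = p} 3≤∣p∣ with nonempty p (ℕ.≤-trans (s≤s z≤n) 3≤∣p∣)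
... | x , x∈p with nonempty (p - x) (1+k≤∣p∣⇒k≤∣p-x∣ p x (ℕ.≤-trans (s≤s (s≤s z≤n)) 3≤∣p∣))
... | y , y∈p-x with nonempty (p - x - y) (1+k≤∣p∣⇒k≤∣p-x∣ (p - x) y (1+k≤∣p∣⇒k≤∣p-x∣ p x 3≤∣p∣))
... | z , z∈p-x-y with x∈p-y⁻ y∈p-x | x∈p-y⁻ z∈p-x-y
... | y∈p , y≢x | z∈p-x , z≢y with x∈p-y⁻ z∈p-x
... | z∈p , z≢x = x , y , z , (x∈p , y∈p , z∈p) , (y≢x ∘ sym , z≢x ∘ sym , z≢y ∘ sym)

-- Matroids

module _ {m : ℕ} (M : Matroid m) where
  open Matroid M

  ∈-cl⁻ : ∀ {A e} → e ∈ cl M A → r (A ∪ ⁅ e ⁆) ≡ r A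
  ∈-cl⁻ {A} {e} = T-does⁻ (r (A ∪ ⁅ e ⁆) ℕ.≟ r A) ∘ ∈-tabulate⁻

  ∈-cl⁺ : ∀ {A e} → r (A ∪ ⁅ e ⁆) ≡ r A → e ∈ cl M A
  ∈-cl⁺ {A} {e} = ∈-tabulate⁺ ∘ T-does⁺ (r (A ∪ ⁅ e ⁆) ℕ.≟ r A)

  ∉-cl⇒r< : ∀ {A e} → e ∉ cl M A → r A < r (A ∪ ⁅ e ⁆)
  ∉-cl⇒r< e∉cl = ℕ.≤∧≢⇒< (r-mono _ _ (p⊆p∪q _)) (e∉cl ∘ ∈-cl⁺ ∘ sym)

  cl-mono : ∀ {A B} → A ⊆ B → cl M A ⊆ cl M B
  cl-mono {A} {B} A⊆B {e} e∈clA = ∈-cl⁺ (ℕ.≤-antisym r[B+e]≤rB (r-mono _ _ (p⊆p∪q _)))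
    where
    B+e⊆A+e∪B : B ∪ ⁅ e ⁆ ⊆ (A ∪ ⁅ e ⁆) ∪ B
    B+e⊆A+e∪B x∈ with x∈p∪q⁻ B ⁅ e ⁆ x∈
    ... | inj₁ x∈B = q⊆p∪q _ B x∈B
    ... | inj₂ x∈e = p⊆p∪q B (q⊆p∪q A ⁅ e ⁆ x∈e)
    r[B+e]≤rB : r (B ∪ ⁅ e ⁆) ≤ r B
    r[B+e]≤rB = ℕ.+-cancelʳ-≤ (r A) _ _ (begin
      r (B ∪ ⁅ e ⁆) + r A                          ≤⟨ ℕ.+-mono-≤ (r-mono _ _ B+e⊆A+e∪B)
                                                         (r-mono _ _ (λ x∈A → x∈p∩q⁺ (p⊆p∪q _ x∈A , A⊆B x∈A))) ⟩
      r ((A ∪ ⁅ e ⁆) ∪ B) + r ((A ∪ ⁅ e ⁆) ∩ B)  ≤⟨ r-submod (A ∪ ⁅ e ⁆) B ⟩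
      r (A ∪ ⁅ e ⁆) + r B                          ≡⟨ cong (_+ r B) (∈-cl⁻ e∈clA) ⟩
      r A + r B                                    ≡⟨ ℕ.+-comm (r A) (r B) ⟩
      r B + r A                                    ∎)
      where open ℕ.≤-Reasoning

  Independent-⊆ : ∀ {I J} → J ⊆ I → Independent M I → Independent M J
  Independent-⊆ {I} {J} J⊆I rI≡∣I∣ = ℕ.≤-antisym (r-bounded J) (ℕ.+-cancelʳ-≤ ∣ I ─ J ∣ _ _ (begin
    ∣ J ∣ + ∣ I ─ J ∣          ≤⟨ ℕ.+-monoˡ-≤ _ (p⊆q⇒∣p∣≤∣q∣ (λ x∈J → x∈p∩q⁺ (J⊆I x∈J , x∈J))) ⟩
    ∣ I ∩ J ∣ + ∣ I ─ J ∣      ≡⟨ ∣p∣≡∣p∩q∣+∣p─q∣ I J ⟨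
    ∣ I ∣                      ≡⟨ rI≡∣I∣ ⟨
    r I                        ≤⟨ r-mono _ _ I⊆J∪[I─J] ⟩
    r (J ∪ (I ─ J))            ≤⟨ ℕ.m≤m+n _ _ ⟩
    r (J ∪ (I ─ J)) + r (J ∩ (I ─ J)) ≤⟨ r-submod J (I ─ J) ⟩
    r J + r (I ─ J)            ≤⟨ ℕ.+-monoʳ-≤ (r J) (r-bounded (I ─ J)) ⟩
    r J + ∣ I ─ J ∣            ∎))
    where
    open ℕ.≤-Reasoning
    I⊆J∪[I─J] : I ⊆ J ∪ (I ─ J)
    I⊆J∪[I─J] {x} x∈I with x ∈? J
    ... | yes x∈J = p⊆p∪q _ x∈J
    ... | no x∉J = q⊆p∪q J _ (x∈p∧x∉q⇒x∈p─q x∈I x∉J)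

  -- Delete elements while some deletion stays dependent; the set left over is a circuit.
  dependent⇒circuit : ∀ k D → ∣ D ∣ ≤ k → ¬ Independent M D → Σ (Subset m) (Circuit M)
  dependent⇒circuit k D ∣D∣≤k D-dep with Fin.any? (λ e → (e ∈? D) ×-dec ¬? (r (D - e) ℕ.≟ ∣ D - e ∣))
  dependent⇒circuit zero D ∣D∣≤0 D-dep | yes (e , e∈D , _) =
    contradiction (ℕ.≤-trans (x∈p⇒1≤∣p∣ e∈D) ∣D∣≤0) λ ()
  dependent⇒circuit (suc k) D ∣D∣≤1+k D-dep | yes (e , e∈D , D-e-dep) =
    dependent⇒circuit k (D - e) (ℕ.≤-pred (ℕ.≤-trans (x∈p⇒∣p-x∣<∣p∣ e∈D) ∣D∣≤1+k)) D-e-dep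
  ... | no no-dependent-deletion = D , D-dep , minimal
    where
    minimal : ∀ J → J ⊆ D → J ≢ D → Independent M J
    minimal J J⊆D J≢D with Fin.any? (λ e → (e ∈? D) ×-dec ¬? (e ∈? J))
    ... | no D⊆J = contradiction (⊆-antisym J⊆D λ {x} x∈D → decidable-stable (x ∈? J) λ x∉J → D⊆J (x , x∈D , x∉J)) J≢D
    ... | yes (e , e∈D , e∉J) = Independent-⊆ J⊆D-e D-e-indep
      where
      J⊆D-e : J ⊆ D - e
      J⊆D-e x∈J = x∈p∧x≢y⇒x∈p-y (J⊆D x∈J) λ { refl → e∉J x∈J }
      D-e-indep : Independent M (D - e)
      D-e-indep with r (D - e) ℕ.≟ ∣ D - e ∣
      ... | yes indep = indep
      ... | no dep = contradiction (e , e∈D , dep) no-dependent-deletion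

-- 3-connected matroids

module _ {m : ℕ} (M : Matroid m) (tc : ThreeConnected M) where
  open Matroid M

  r⊤+1≤rX+r∁X : ∀ X → 1 ≤ ∣ X ∣ → 1 ≤ ∣ ∁ X ∣ → r ⊤ + 1 ≤ r X + r (∁ X)
  r⊤+1≤rX+r∁X X = tc X 1 ℕ.≤-refl (s≤s (s≤s z≤n))

  r⊤+2≤rX+r∁X : ∀ X → 2 ≤ ∣ X ∣ → 2 ≤ ∣ ∁ X ∣ → r ⊤ + 2 ≤ r X + r (∁ X)
  r⊤+2≤rX+r∁X X = tc X 2 (s≤s z≤n) ℕ.≤-refl

  small-side : ∀ X → r X + r (∁ X) ≤ r ⊤ + 1 → ∣ X ∣ ≤ 1 ⊎ ∣ ∁ X ∣ ≤ 1
  small-side X rX+r∁X≤r⊤+1 with 2 ≤? ∣ X ∣ | 2 ≤? ∣ ∁ X ∣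
  ... | no ∣X∣≱2 | _ = inj₁ (ℕ.≤-pred (ℕ.≰⇒> ∣X∣≱2))
  ... | yes _ | no ∣∁X∣≱2 = inj₂ (ℕ.≤-pred (ℕ.≰⇒> ∣∁X∣≱2))
  ... | yes 2≤∣X∣ | yes 2≤∣∁X∣ =
    contradiction (ℕ.+-cancelˡ-≤ (r ⊤) 2 1 (ℕ.≤-trans (r⊤+2≤rX+r∁X X 2≤∣X∣ 2≤∣∁X∣) rX+r∁X≤r⊤+1)) λ { (s≤s ()) }

  ∣X∣≡1⇒r⊤≤r∁X : ∀ X → ∣ X ∣ ≡ 1 → 1 ≤ ∣ ∁ X ∣ → r ⊤ ≤ r (∁ X)
  ∣X∣≡1⇒r⊤≤r∁X X ∣X∣≡1 1≤∣∁X∣ = ℕ.+-cancelʳ-≤ 1 _ _ (begin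
    r ⊤ + 1        ≤⟨ r⊤+1≤rX+r∁X X (ℕ.≤-reflexive (sym ∣X∣≡1)) 1≤∣∁X∣ ⟩
    r X + r (∁ X)  ≤⟨ ℕ.+-monoˡ-≤ (r (∁ X)) (ℕ.≤-trans (r-bounded X) (ℕ.≤-reflexive ∣X∣≡1)) ⟩
    1 + r (∁ X)    ≡⟨ ℕ.+-comm 1 (r (∁ X)) ⟩
    r (∁ X) + 1    ∎)
    where open ℕ.≤-Reasoning

  small-independent : ∀ X → 1 ≤ ∣ X ∣ → ∣ X ∣ < 3 → ∣ X ∣ ≤ ∣ ∁ X ∣ → Independent M X
  small-independent X 1≤∣X∣ ∣X∣<3 ∣X∣≤∣∁X∣ = ℕ.≤-antisym (r-bounded X) (ℕ.+-cancelˡ-≤ (r ⊤) _ _ (begin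
    r ⊤ + ∣ X ∣    ≤⟨ tc X ∣ X ∣ 1≤∣X∣ ∣X∣<3 ℕ.≤-refl ∣X∣≤∣∁X∣ ⟩
    r X + r (∁ X)  ≤⟨ ℕ.+-monoʳ-≤ (r X) (r-mono _ _ ⊆⊤) ⟩
    r X + r ⊤      ≡⟨ ℕ.+-comm (r X) (r ⊤) ⟩
    r ⊤ + r X      ∎))
    where open ℕ.≤-Reasoning

  circuit-size : 4 ≤ m → ∀ {C} → Circuit M C → 3 ≤ ∣ C ∣
  circuit-size 4≤m {C} (C-dep , _) = ℕ.≮⇒≥ λ ∣C∣<3 →
    C-dep (small-independent C 1≤∣C∣ ∣C∣<3 (∣C∣≤∣∁C∣ (ℕ.≤-pred ∣C∣<3)))
    where
    1≤∣C∣ : 1 ≤ ∣ C ∣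
    1≤∣C∣ = ℕ.≮⇒≥ λ ∣C∣<1 → C-dep (let ∣C∣≡0 = ℕ.n<1⇒n≡0 ∣C∣<1 in
      trans (ℕ.n≤0⇒n≡0 (subst (r C ≤_) ∣C∣≡0 (r-bounded C))) (sym ∣C∣≡0))
    ∣C∣≤∣∁C∣ : ∣ C ∣ ≤ 2 → ∣ C ∣ ≤ ∣ ∁ C ∣
    ∣C∣≤∣∁C∣ ∣C∣≤2 = subst (∣ C ∣ ≤_) (sym (∣∁p∣≡n∸∣p∣ C))
      (ℕ.m+n≤o⇒m≤o∸n ∣ C ∣ (ℕ.≤-trans (ℕ.+-mono-≤ ∣C∣≤2 ∣C∣≤2) 4≤m))

  r⊤≤r∁⁅e⁆ : 2 ≤ m → ∀ e → r ⊤ ≤ r (∁ ⁅ e ⁆)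
  r⊤≤r∁⁅e⁆ 2≤m e = ∣X∣≡1⇒r⊤≤r∁X ⁅ e ⁆ (∣⁅x⁆∣≡1 e) (subst (1 ≤_) (sym (∣∁⁅x⁆∣≡n∸1 e)) (ℕ.∸-monoˡ-≤ 1 2≤m))

  ⊤-dependent : 2 ≤ m → ¬ Independent M ⊤
  ⊤-dependent 2≤m r⊤≡∣⊤∣ = ℕ.<⇒≱ (ℕ.∸-monoʳ-< (s≤s z≤n) 1≤m) (begin
    m            ≡⟨ ∣⊤∣≡n m ⟨
    ∣ ⊤ {m} ∣    ≡⟨ r⊤≡∣⊤∣ ⟨
    r ⊤          ≤⟨ r⊤≤r∁⁅e⁆ 2≤m e ⟩
    r (∁ ⁅ e ⁆)  ≤⟨ r-bounded (∁ ⁅ e ⁆) ⟩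
    ∣ ∁ ⁅ e ⁆ ∣  ≡⟨ ∣∁⁅x⁆∣≡n∸1 e ⟩
    m ∸ 1        ∎)
    where
    open ℕ.≤-Reasoning
    1≤m : 1 ≤ m
    1≤m = ℕ.≤-trans (s≤s z≤n) 2≤m
    e : Fin m
    e = proj₁ (nonempty ⊤ (subst (1 ≤_) (sym (∣⊤∣≡n m)) 1≤m))

-- Graphs

module _ {m : ℕ} (G : Graph m) where
  open Graph G

  end₁ end₂ : Fin m → Fin n
  end₁ f = proj₁ (ends f)
  end₂ f = proj₂ (ends f)

  Joins : Fin m → Fin n → Fin n → Set
  Joins f u w = ends f ≡ (u , w) ⊎ ends f ≡ (w , u)

  Incident? : ∀ f v → Dec (Incident G f v)
  Incident? f v = (end₁ f ≟ v) ⊎-dec (end₂ f ≟ v)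

  ∈-edgesAvoiding⁻ : ∀ {f v} → f ∈ edgesAvoiding G v → ¬ Incident G f v
  ∈-edgesAvoiding⁻ {f} {v} = T-does⁻ (¬? (Incident? f v)) ∘ ∈-tabulate⁻

  ∈-edgesAvoiding⁺ : ∀ {f v} → ¬ Incident G f v → f ∈ edgesAvoiding G v
  ∈-edgesAvoiding⁺ {f} {v} = ∈-tabulate⁺ ∘ T-does⁺ (¬? (Incident? f v))

  ∈-loops⁻ : ∀ {f v} → f ∈ loops G v → IsLoopAt G f v
  ∈-loops⁻ {f} {v} = T-does⁻ ((end₁ f ≟ v) ×-dec (end₂ f ≟ v)) ∘ ∈-tabulate⁻

  ∈-loops⁺ : ∀ {f v} → IsLoopAt G f v → f ∈ loops G v
  ∈-loops⁺ {f} {v} = ∈-tabulate⁺ ∘ T-does⁺ ((end₁ f ≟ v) ×-dec (end₂ f ≟ v))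

  ∈-edgesOf⁻ : ∀ {f S} → f ∈ edgesOf G S → end₁ f ∈ S × end₂ f ∈ S
  ∈-edgesOf⁻ {f} {S} = T-does⁻ ((end₁ f ∈? S) ×-dec (end₂ f ∈? S)) ∘ ∈-tabulate⁻

  ∈-edgesOf⁺ : ∀ {f S} → end₁ f ∈ S → end₂ f ∈ S → f ∈ edgesOf G S
  ∈-edgesOf⁺ {f} {S} f₁∈S f₂∈S = ∈-tabulate⁺ (T-does⁺ ((end₁ f ∈? S) ×-dec (end₂ f ∈? S)) (f₁∈S , f₂∈S))

  ∈-edgesOf-Incident : ∀ {f v S} → f ∈ edgesOf G S → Incident G f v → v ∈ S
  ∈-edgesOf-Incident f∈ (inj₁ refl) = proj₁ (∈-edgesOf⁻ f∈)
  ∈-edgesOf-Incident f∈ (inj₂ refl) = proj₂ (∈-edgesOf⁻ f∈)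

  Joins⇒∈edgesOf : ∀ {f u w S} → Joins f u w → u ∈ S → w ∈ S → f ∈ edgesOf G S
  Joins⇒∈edgesOf (inj₁ refl) u∈S w∈S = ∈-edgesOf⁺ u∈S w∈S
  Joins⇒∈edgesOf (inj₂ refl) u∈S w∈S = ∈-edgesOf⁺ w∈S u∈S

  Joins-sym : ∀ {f u w} → Joins f u w → Joins f w u
  Joins-sym (inj₁ f≡uw) = inj₂ f≡uw
  Joins-sym (inj₂ f≡wu) = inj₁ f≡wu

  Joins⇒Incidentˡ : ∀ {f u w} → Joins f u w → Incident G f u
  Joins⇒Incidentˡ (inj₁ refl) = inj₁ refl
  Joins⇒Incidentˡ (inj₂ refl) = inj₂ refl

  Joins⇒Incidentʳ : ∀ {f u w} → Joins f u w → Incident G f w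
  Joins⇒Incidentʳ = Joins⇒Incidentˡ ∘ Joins-sym

  Joins-IsLoopAt : ∀ {f u w} → Joins f u w → IsLoopAt G f w → u ≡ w
  Joins-IsLoopAt (inj₁ refl) (u≡w , _) = u≡w
  Joins-IsLoopAt (inj₂ refl) (_ , u≡w) = u≡w

  ConnectedIn-sym : ∀ {X u w} → ConnectedIn G X u w → ConnectedIn G X w u
  ConnectedIn-sym = Star.reverse λ (f , f∈X , j) → f , f∈X , Joins-sym j

  ConnectedIn⇒Connected : ∀ {X u w} → ConnectedIn G X u w → Connected G u w
  ConnectedIn⇒Connected = Star.map λ (f , _ , j) → f , ∈⊤ , j

relabel : ∀ {m n′} (G : Graph m) → (Fin (Graph.n G) → Fin n′) → Graph m
relabel {n′ = n′} G φ = record { n = n′ ; ends = λ f → φ (end₁ G f) , φ (end₂ G f) }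

module _ {m n′ : ℕ} (G : Graph m) (φ : Fin (Graph.n G) → Fin n′) where

  Joins-relabel : ∀ {f u w} → Joins G f u w → Joins (relabel G φ) f (φ u) (φ w)
  Joins-relabel (inj₁ refl) = inj₁ refl
  Joins-relabel (inj₂ refl) = inj₂ refl

  ConnectedIn-relabel : ∀ {X u w} → ConnectedIn G X u w → ConnectedIn (relabel G φ) X (φ u) (φ w)
  ConnectedIn-relabel = Star.gmap φ λ (f , f∈X , j) → f , f∈X , Joins-relabel j

  Incident-relabel⁻ : ∀ {f a′} → Incident (relabel G φ) f a′ → ∃[ a ] (Incident G f a × φ a ≡ a′)
  Incident-relabel⁻ (inj₁ φf₁≡a′) = _ , inj₁ refl , φf₁≡a′
  Incident-relabel⁻ (inj₂ φf₂≡a′) = _ , inj₂ refl , φf₂≡a′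

  Incident-relabel⁺ : ∀ {f a} → Incident G f a → Incident (relabel G φ) f (φ a)
  Incident-relabel⁺ (inj₁ f₁≡a) = inj₁ (cong φ f₁≡a)
  Incident-relabel⁺ (inj₂ f₂≡a) = inj₂ (cong φ f₂≡a)

  IsLoopAt-relabel : ∀ {f a} → IsLoopAt G f a → IsLoopAt (relabel G φ) f (φ a)
  IsLoopAt-relabel (f₁≡a , f₂≡a) = cong φ f₁≡a , cong φ f₂≡a

  VertexOf-relabel⁻ : ∀ {C a′} → VertexOf (relabel G φ) C a′ → ∃[ a ] (VertexOf G C a × φ a ≡ a′)
  VertexOf-relabel⁻ (f , f∈C , inc) = Product.map₂ (Product.map₁ (λ inc → f , f∈C , inc)) (Incident-relabel⁻ inc)

  AtMostTwoComponents-relabel : ∀ {C} → AtMostTwoComponents G C → AtMostTwoComponents (relabel G φ) C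
  AtMostTwoComponents-relabel two a₁′ a₂′ a₃′ a₁′∈ a₂′∈ a₃′∈
    with VertexOf-relabel⁻ a₁′∈ | VertexOf-relabel⁻ a₂′∈ | VertexOf-relabel⁻ a₃′∈
  ... | a₁ , a₁∈ , refl | a₂ , a₂∈ , refl | a₃ , a₃∈ , refl with two a₁ a₂ a₃ a₁∈ a₂∈ a₃∈
  ... | inj₁ a₁~a₂ = inj₁ (ConnectedIn-relabel a₁~a₂)
  ... | inj₂ (inj₁ a₁~a₃) = inj₂ (inj₁ (ConnectedIn-relabel a₁~a₃))
  ... | inj₂ (inj₂ a₂~a₃) = inj₂ (inj₂ (ConnectedIn-relabel a₂~a₃))

-- Frameworks and their components

module _ {m : ℕ} (M : Matroid m) (G : Graph m) where
  open Matroid M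
  open Graph G

  ComponentRankCondition ClosureCondition : Set
  ComponentRankCondition = ∀ S → IsComponent G S → r (edgesOf G S) ≤ ∣ S ∣
  ClosureCondition = ∀ v → cl M (edgesAvoiding G v) ⊆ (edgesAvoiding G v ∪ loops G v)

  Avoids : Subset m → Subset n → Set
  Avoids Y S = ∀ {f v} → f ∈ Y → Incident G f v → v ∉ S

  RankBound : Subset n → Set
  RankBound S = ∀ Y → Avoids Y S → r Y + ∣ S ∣ ≤ r (Y ∪ edgesOf G S) + 1

  RankBound-⁅⁆ : ∀ v → RankBound ⁅ v ⁆
  RankBound-⁅⁆ v Y _ = ℕ.+-mono-≤ (r-mono _ _ (p⊆p∪q _)) (ℕ.≤-reflexive (∣⁅x⁆∣≡1 v))

  ClosureCondition⇒∉cl : ClosureCondition → ∀ {f w} → Incident G f w → ¬ IsLoopAt G f w →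
                         f ∉ cl M (edgesAvoiding G w)
  ClosureCondition⇒∉cl cc {w = w} inc ¬loop f∈cl with x∈p∪q⁻ _ _ (cc w f∈cl)
  ... | inj₁ f-avoids = ∈-edgesAvoiding⁻ G f-avoids inc
  ... | inj₂ f-loop = ¬loop (∈-loops⁻ G f-loop)

  -- The edge f reaching the new vertex w is not in cl(E(G - w)) ⊇ Y ∪ E(P), so it raises the rank.
  RankBound-extend : ClosureCondition → ∀ {f u w P} → Joins G f u w → u ∈ P → w ∉ P →
                     RankBound P → RankBound (P ∪ ⁅ w ⁆)
  RankBound-extend cc {f} {u} {w} {P} f-joins u∈P w∉P rb Y Y-avoids = begin
    r Y + ∣ P ∪ ⁅ w ⁆ ∣                ≡⟨ cong (r Y +_) (∣p∪⁅x⁆∣≡1+∣p∣ P w w∉P) ⟩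
    r Y + suc ∣ P ∣                    ≡⟨ ℕ.+-suc (r Y) ∣ P ∣ ⟩
    suc (r Y + ∣ P ∣)                  ≤⟨ s≤s (rb Y λ f∈Y inc v∈P → Y-avoids f∈Y inc (p⊆p∪q _ v∈P)) ⟩
    suc (r B) + 1                      ≤⟨ ℕ.+-monoˡ-≤ 1 (ℕ.≤-trans (∉-cl⇒r< M f∉clB) (r-mono _ _ B+f⊆)) ⟩
    r (Y ∪ edgesOf G (P ∪ ⁅ w ⁆)) + 1  ∎
    where
    open ℕ.≤-Reasoning
    w∈P+w : w ∈ P ∪ ⁅ w ⁆
    w∈P+w = q⊆p∪q P _ (x∈⁅x⁆ w)
    B = Y ∪ edgesOf G P
    B⊆E[G-w] : B ⊆ edgesAvoiding G w
    B⊆E[G-w] g∈B with x∈p∪q⁻ Y _ g∈B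
    ... | inj₁ g∈Y = ∈-edgesAvoiding⁺ G λ inc → Y-avoids g∈Y inc w∈P+w
    ... | inj₂ g∈E[P] = ∈-edgesAvoiding⁺ G λ inc → w∉P (∈-edgesOf-Incident G g∈E[P] inc)
    f∉clB : f ∉ cl M B
    f∉clB = ClosureCondition⇒∉cl cc (Joins⇒Incidentʳ G f-joins)
              (λ loop → w∉P (subst (_∈ P) (Joins-IsLoopAt G f-joins loop) u∈P))
            ∘ cl-mono M B⊆E[G-w]
    E[P]⊆E[P+w] : edgesOf G P ⊆ edgesOf G (P ∪ ⁅ w ⁆)
    E[P]⊆E[P+w] g∈ = ∈-edgesOf⁺ G (p⊆p∪q _ (proj₁ (∈-edgesOf⁻ G g∈))) (p⊆p∪q _ (proj₂ (∈-edgesOf⁻ G g∈)))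
    f∈E[P+w] : f ∈ edgesOf G (P ∪ ⁅ w ⁆)
    f∈E[P+w] = Joins⇒∈edgesOf G f-joins (p⊆p∪q _ u∈P) w∈P+w
    B+f⊆ : B ∪ ⁅ f ⁆ ⊆ Y ∪ edgesOf G (P ∪ ⁅ w ⁆)
    B+f⊆ g∈ with x∈p∪q⁻ B _ g∈
    ... | inj₂ g∈⁅f⁆ = q⊆p∪q Y _ (subst (_∈ _) (sym (x∈⁅y⁆⇒x≡y f g∈⁅f⁆)) f∈E[P+w])
    ... | inj₁ g∈B with x∈p∪q⁻ Y _ g∈B
    ...   | inj₁ g∈Y = p⊆p∪q _ g∈Y
    ...   | inj₂ g∈E[P] = q⊆p∪q Y _ (E[P]⊆E[P+w] g∈E[P])

  IsConnected⇒ComponentRankCondition : IsConnected G → r ⊤ ≤ n → ComponentRankCondition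
  IsConnected⇒ComponentRankCondition connected r⊤≤n S ((a , a∈S) , S-closed) = begin
    r (edgesOf G S)  ≤⟨ r-mono _ _ ⊆⊤ ⟩
    r ⊤              ≤⟨ r⊤≤n ⟩
    n                ≡⟨ ∣⊤∣≡n n ⟨
    ∣ ⊤ {n} ∣        ≤⟨ p⊆q⇒∣p∣≤∣q∣ {p = ⊤} (λ {x} _ → proj₁ (S-closed a x a∈S) (connected a x)) ⟩
    ∣ S ∣            ∎
    where open ℕ.≤-Reasoning

  Closed : Subset n → Set
  Closed S = ∀ {f u} → Incident G f u → u ∈ S → f ∈ edgesOf G S

  record Grown (v : Fin n) (P : Subset n) : Set where
    field
      v∈P : v ∈ P
      reach : ∀ {u} → u ∈ P → Connected G v u
      rankBound : RankBound P

  record ComponentOf (v : Fin n) : Set where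
    field
      vertices : Subset n
      v∈vertices : v ∈ vertices
      reach : ∀ {u} → u ∈ vertices → Connected G v u
      closed : Closed vertices
      rankBound : RankBound vertices

  Grown-⁅⁆ : ∀ v → Grown v ⁅ v ⁆
  Grown-⁅⁆ v = record
    { v∈P = x∈⁅x⁆ v
    ; reach = λ u∈⁅v⁆ → subst (Connected G v) (sym (x∈⁅y⁆⇒x≡y v u∈⁅v⁆)) ε
    ; rankBound = RankBound-⁅⁆ v
    }

  Grown-extend : ClosureCondition → ∀ {v P f u w} → Joins G f u w → u ∈ P → w ∉ P →
                 Grown v P → Grown v (P ∪ ⁅ w ⁆)
  Grown-extend cc {v} {P} {f} {u} {w} f-joins u∈P w∉P g = record
    { v∈P = p⊆p∪q _ v∈P
    ; reach = reach′
    ; rankBound = RankBound-extend cc f-joins u∈P w∉P rankBound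
    }
    where
    open Grown g
    reach′ : ∀ {x} → x ∈ P ∪ ⁅ w ⁆ → Connected G v x
    reach′ x∈ with x∈p∪q⁻ P _ x∈
    ... | inj₁ x∈P = reach x∈P
    ... | inj₂ x∈⁅w⁆ = subst (Connected G v) (sym (x∈⁅y⁆⇒x≡y w x∈⁅w⁆)) (reach u∈P ◅◅ ((f , ∈⊤ , f-joins) ◅ ε))

  Crossing : Subset n → Fin m → Set
  Crossing P f = (end₁ G f ∈ P × end₂ G f ∉ P) ⊎ (end₂ G f ∈ P × end₁ G f ∉ P)

  Crossing? : ∀ P f → Dec (Crossing P f)
  Crossing? P f = ((end₁ G f ∈? P) ×-dec ¬? (end₂ G f ∈? P)) ⊎-dec ((end₂ G f ∈? P) ×-dec ¬? (end₁ G f ∈? P))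

  ∄Crossing⇒Closed : ∀ {P} → ¬ ∃ (Crossing P) → Closed P
  ∄Crossing⇒Closed {P} ∄ {f} (inj₁ refl) f₁∈P with end₂ G f ∈? P
  ... | yes f₂∈P = ∈-edgesOf⁺ G f₁∈P f₂∈P
  ... | no f₂∉P = contradiction (f , inj₁ (f₁∈P , f₂∉P)) ∄
  ∄Crossing⇒Closed {P} ∄ {f} (inj₂ refl) f₂∈P with end₁ G f ∈? P
  ... | yes f₁∈P = ∈-edgesOf⁺ G f₁∈P f₂∈P
  ... | no f₁∉P = contradiction (f , inj₂ (f₂∈P , f₁∉P)) ∄

  module _ (cc : ClosureCondition) {v : Fin n} where

    grow : ∀ t {P} → n ≤ ∣ P ∣ + t → Grown v P → ComponentOf v
    grow-across : ∀ t {P f u w} → n ≤ ∣ P ∣ + t → Grown v P → Joins G f u w → u ∈ P → w ∉ P → ComponentOf v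

    grow t {P} n≤ g with Fin.any? (Crossing? P)
    ... | no ∄ = record
      { vertices = P ; v∈vertices = v∈P ; reach = reach ; closed = ∄Crossing⇒Closed ∄ ; rankBound = rankBound }
      where open Grown g
    ... | yes (f , inj₁ (f₁∈P , f₂∉P)) = grow-across t n≤ g (inj₁ refl) f₁∈P f₂∉P
    ... | yes (f , inj₂ (f₂∈P , f₁∉P)) = grow-across t n≤ g (inj₂ refl) f₂∈P f₁∉P

    grow-across zero {P} n≤∣P∣+0 _ _ _ w∉P = contradiction (subst (_ ∈_) (sym P≡⊤) ∈⊤) w∉P
      where
      P≡⊤ : P ≡ ⊤
      P≡⊤ = ∣p∣≡n⇒p≡⊤ (ℕ.≤-antisym (∣p∣≤n P) (subst (n ≤_) (ℕ.+-identityʳ _) n≤∣P∣+0))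
    grow-across (suc t) {P} {w = w} n≤ g f-joins u∈P w∉P =
      grow t (subst (n ≤_) ∣P∣+1+t≡∣P+w∣+t n≤) (Grown-extend cc f-joins u∈P w∉P g)
      where
      ∣P∣+1+t≡∣P+w∣+t : ∣ P ∣ + suc t ≡ ∣ P ∪ ⁅ w ⁆ ∣ + t
      ∣P∣+1+t≡∣P+w∣+t = trans (ℕ.+-suc ∣ P ∣ t) (cong (_+ t) (sym (∣p∪⁅x⁆∣≡1+∣p∣ P w w∉P)))

  componentOf : ClosureCondition → ∀ v → ComponentOf v
  componentOf cc v = grow cc n (subst (n ≤_) (cong (_+ n) (sym (∣⁅x⁆∣≡1 v))) (ℕ.n≤1+n n)) (Grown-⁅⁆ v)

  module _ {v : Fin n} (C : ComponentOf v) where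
    open ComponentOf C

    Connected-closed : ∀ {a b} → a ∈ vertices → Connected G a b → b ∈ vertices
    Connected-closed a∈ ε = a∈
    Connected-closed a∈ ((f , _ , f-joins) ◅ path) =
      Connected-closed (∈-edgesOf-Incident G (closed (Joins⇒Incidentˡ G f-joins) a∈) (Joins⇒Incidentʳ G f-joins)) path

    isComponent : IsComponent G vertices
    isComponent = (v , v∈vertices) , λ a b a∈ → Connected-closed a∈ , λ b∈ → ConnectedIn-sym G (reach a∈) ◅◅ reach b∈

    r∁E+∣V∣≤r⊤+1 : r (∁ (edgesOf G vertices)) + ∣ vertices ∣ ≤ r ⊤ + 1
    r∁E+∣V∣≤r⊤+1 = ℕ.≤-trans (rankBound _ ∁E-avoids) (ℕ.+-monoˡ-≤ 1 (r-mono _ _ ⊆⊤))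
      where
      ∁E-avoids : Avoids (∁ (edgesOf G vertices)) vertices
      ∁E-avoids f∈∁E inc a∈ = x∈∁p⇒x∉p f∈∁E (closed inc a∈)

    rE+r∁E≤r⊤+1 : ComponentRankCondition → r (edgesOf G vertices) + r (∁ (edgesOf G vertices)) ≤ r ⊤ + 1
    rE+r∁E≤r⊤+1 crc = begin
      r (edgesOf G vertices) + r (∁ (edgesOf G vertices)) ≤⟨ ℕ.+-monoˡ-≤ _ (crc vertices isComponent) ⟩
      ∣ vertices ∣ + r (∁ (edgesOf G vertices))         ≡⟨ ℕ.+-comm ∣ vertices ∣ _ ⟩
      r (∁ (edgesOf G vertices)) + ∣ vertices ∣         ≤⟨ r∁E+∣V∣≤r⊤+1 ⟩
      r ⊤ + 1                                           ∎
      where open ℕ.≤-Reasoning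

module FrameworkComponents {m : ℕ} (M : Matroid m) (G : Graph m)
  (tc : ThreeConnected M) (fw : IsFramework M G) (niv : NoIsolatedVertices G) where
  open Matroid M
  open Graph G

  component : ∀ v → ComponentOf M G v
  component = componentOf M G (proj₁ (proj₂ fw))

  open module Component {v} = ComponentOf (component v) using (vertices; v∈vertices; reach; closed)

  edges : Fin n → Subset m
  edges v = edgesOf G (vertices {v})

  edges-nonempty : ∀ v → 1 ≤ ∣ edges v ∣
  edges-nonempty v = x∈p⇒1≤∣p∣ (closed (proj₂ (niv v)) v∈vertices)

  small-side-edges : ∀ v → ∣ edges v ∣ ≤ 1 ⊎ ∣ ∁ (edges v) ∣ ≤ 1
  small-side-edges v = small-side M tc (edges v) (rE+r∁E≤r⊤+1 M G (component v) (proj₁ fw))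

  ∣vertices∣≤1 : ∀ v → ∣ edges v ∣ ≤ 1 → 1 ≤ ∣ ∁ (edges v) ∣ → ∣ vertices {v} ∣ ≤ 1
  ∣vertices∣≤1 v ∣E∣≤1 1≤∣∁E∣ = ℕ.+-cancelˡ-≤ (r ⊤) _ _ (begin
    r ⊤ + ∣ vertices ∣              ≤⟨ ℕ.+-monoˡ-≤ _ (∣X∣≡1⇒r⊤≤r∁X M tc (edges v) ∣E∣≡1 1≤∣∁E∣) ⟩
    r (∁ (edges v)) + ∣ vertices ∣  ≤⟨ r∁E+∣V∣≤r⊤+1 M G (component v) ⟩
    r ⊤ + 1                         ∎)
    where
    open ℕ.≤-Reasoning
    ∣E∣≡1 : ∣ edges v ∣ ≡ 1
    ∣E∣≡1 = ℕ.≤-antisym ∣E∣≤1 (edges-nonempty v)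

  edges-disjoint : ∀ {u w} → w ∉ vertices {u} → edges w ⊆ ∁ (edges u)
  edges-disjoint {u} {w} w∉Vu f∈Ew = x∉p⇒x∈∁p λ f∈Eu →
    w∉Vu (Connected-closed M G (component u) (proj₁ (∈-edgesOf⁻ G f∈Eu))
           (ConnectedIn-sym G (reach (proj₁ (∈-edgesOf⁻ G f∈Ew)))))

  ∣∁edges∣≡0⇒connected : ∀ u → ∣ ∁ (edges u) ∣ ≡ 0 → IsConnected G
  ∣∁edges∣≡0⇒connected u ∣∁E∣≡0 a b = ConnectedIn-sym G (reach (∈Vu a)) ◅◅ reach (∈Vu b)
    where
    ∈Vu : ∀ a → a ∈ vertices {u}
    ∈Vu a = ∈-edgesOf-Incident G (x∉∁p⇒x∈p λ g∈∁E → contradiction (ℕ.≤-trans (x∈p⇒1≤∣p∣ g∈∁E) (ℕ.≤-reflexive ∣∁E∣≡0)) λ ())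
              (proj₂ (niv a))

  ∣∁edges∣≡1⇒loopComponent : ∀ u → ∣ ∁ (edges u) ∣ ≡ 1 → TwoComponentsOneLoopComponent G
  ∣∁edges∣≡1⇒loopComponent u ∣∁Eu∣≡1 = w , e , (refl , e₂≡w) , only-e , (u , u≢w) , connected-off-w
    where
    e = proj₁ (nonempty (∁ (edges u)) (ℕ.≤-reflexive (sym ∣∁Eu∣≡1)))
    e∈∁Eu = proj₂ (nonempty (∁ (edges u)) (ℕ.≤-reflexive (sym ∣∁Eu∣≡1)))
    w = end₁ G e
    w∉Vu : w ∉ vertices {u}
    w∉Vu w∈Vu = x∈∁p⇒x∉p e∈∁Eu (closed (inj₁ refl) w∈Vu)
    ∣Ew∣≤1 : ∣ edges w ∣ ≤ 1
    ∣Ew∣≤1 = ℕ.≤-trans (p⊆q⇒∣p∣≤∣q∣ (edges-disjoint w∉Vu)) (ℕ.≤-reflexive ∣∁Eu∣≡1)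
    1≤∣∁Ew∣ : 1 ≤ ∣ ∁ (edges w) ∣
    1≤∣∁Ew∣ = ℕ.≤-trans (edges-nonempty u)
      (p⊆q⇒∣p∣≤∣q∣ λ f∈Eu → x∉p⇒x∈∁p λ f∈Ew → x∈∁p⇒x∉p (edges-disjoint w∉Vu f∈Ew) f∈Eu)
    e∈Ew : e ∈ edges w
    e∈Ew = closed (inj₁ refl) v∈vertices
    e₂≡w : end₂ G e ≡ w
    e₂≡w = ∣p∣≤1⇒x≡y (∣vertices∣≤1 w ∣Ew∣≤1 1≤∣∁Ew∣) (proj₂ (∈-edgesOf⁻ G e∈Ew)) v∈vertices
    only-e : ∀ f → Incident G f w → f ≡ e
    only-e f inc = ∣p∣≤1⇒x≡y ∣Ew∣≤1 (closed inc v∈vertices) e∈Ew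
    u≢w : u ≢ w
    u≢w u≡w = w∉Vu (subst (_∈ vertices {u}) u≡w v∈vertices)
    e-incident⇒≡w : ∀ {a} → Incident G e a → a ≡ w
    e-incident⇒≡w (inj₁ refl) = refl
    e-incident⇒≡w (inj₂ refl) = e₂≡w
    ∈Vu : ∀ a → a ≢ w → a ∈ vertices {u}
    ∈Vu a a≢w with niv a
    ... | g , inc with g ∈? edges u
    ...   | yes g∈Eu = ∈-edgesOf-Incident G g∈Eu inc
    ...   | no g∉Eu = contradiction (e-incident⇒≡w (subst (λ g → Incident G g a) g≡e inc)) a≢w
      where
      g≡e : g ≡ e
      g≡e = ∣p∣≤1⇒x≡y (ℕ.≤-reflexive ∣∁Eu∣≡1) (x∉p⇒x∈∁p g∉Eu) e∈∁Eu
    connected-off-w : ∀ a b → a ≢ w → b ≢ w → Connected G a b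
    connected-off-w a b a≢w b≢w = ConnectedIn-sym G (reach (∈Vu a a≢w)) ◅◅ reach (∈Vu b b≢w)

  single-edge-components⇒≡ : (∀ v → ∣ edges v ∣ ≤ 1) →
                             ∀ {X c c′} → ConnectedIn G X (end₁ G c) (end₁ G c′) → c ≡ c′
  single-edge-components⇒≡ single {c = c} {c′} path =
    ∣p∣≤1⇒x≡y (single (end₁ G c)) (closed (inj₁ refl) v∈vertices)
      (closed (inj₁ refl) (Connected-closed M G (component (end₁ G c)) v∈vertices (ConnectedIn⇒Connected G path)))

  ¬single-edge-components : 4 ≤ m → ¬ (∀ v → ∣ edges v ∣ ≤ 1)
  ¬single-edge-components 4≤m single
    with dependent⇒circuit M m ⊤ (∣p∣≤n ⊤) (⊤-dependent M tc (ℕ.≤-trans (s≤s (s≤s z≤n)) 4≤m))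
  ... | C , C-circuit with three-distinct (circuit-size M tc 4≤m C-circuit)
  ... | c₁ , c₂ , c₃ , (c₁∈C , c₂∈C , c₃∈C) , (c₁≢c₂ , c₁≢c₃ , c₂≢c₃)
    with proj₂ (proj₂ fw) C C-circuit _ _ _ (c₁ , c₁∈C , inj₁ refl) (c₂ , c₂∈C , inj₁ refl) (c₃ , c₃∈C , inj₁ refl)
  ... | inj₁ c₁~c₂ = c₁≢c₂ (single-edge-components⇒≡ single c₁~c₂)
  ... | inj₂ (inj₁ c₁~c₃) = c₁≢c₃ (single-edge-components⇒≡ single c₁~c₃)
  ... | inj₂ (inj₂ c₂~c₃) = c₂≢c₃ (single-edge-components⇒≡ single c₂~c₃)

-- Removing a loop-component

merge : ∀ {n} {w u : Fin n} → u ≢ w → Fin n → Fin (n ∸ 1)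
merge {suc k} {w} u≢w a with w ≟ a
... | yes _ = punchOut (u≢w ∘ sym)
... | no w≢a = punchOut w≢a

merge-injective : ∀ {n} {w u : Fin n} (u≢w : u ≢ w) {a b} → a ≢ w → b ≢ w → merge u≢w a ≡ merge u≢w b → a ≡ b
merge-injective {suc k} {w} u≢w {a} {b} a≢w b≢w eq with w ≟ a | w ≟ b
... | yes w≡a | _ = contradiction (sym w≡a) a≢w
... | no _ | yes w≡b = contradiction (sym w≡b) b≢w
... | no w≢a | no w≢b = Fin.punchOut-injective w≢a w≢b eq

merge-surjective : ∀ {n} {w u : Fin n} (u≢w : u ≢ w) b → ∃[ a ] (a ≢ w × merge u≢w a ≡ b)
merge-surjective {suc k} {w} u≢w b = punchIn w b , Fin.punchInᵢ≢i w b , merge-punchIn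
  where
  merge-punchIn : merge u≢w (punchIn w b) ≡ b
  merge-punchIn with w ≟ punchIn w b
  ... | yes w≡b = contradiction (sym w≡b) (Fin.punchInᵢ≢i w b)
  ... | no w≢b = trans (Fin.punchOut-cong w refl) (Fin.punchOut-punchIn w)

module MergeLoopComponent {m : ℕ} (M : Matroid m) (G : Graph m)
  (tc : ThreeConnected M) (2≤m : 2 ≤ m) (fw : IsFramework M G)
  {w : Fin (Graph.n G)} {e : Fin m} (e-loop : IsLoopAt G e w) (only-e : ∀ f → Incident G f w → f ≡ e)
  {u : Fin (Graph.n G)} (u≢w : u ≢ w) (connected-off-w : ∀ a b → a ≢ w → b ≢ w → Connected G a b) where
  open Matroid M
  open Graph G

  Connected-preserves-≢w : ∀ {a b} → Connected G a b → a ≢ w → b ≢ w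
  Connected-preserves-≢w ε a≢w = a≢w
  Connected-preserves-≢w ((f , _ , f-joins) ◅ path) a≢w = Connected-preserves-≢w path c≢w
    where
    c≢w : _ ≢ w
    c≢w refl = a≢w (Joins-IsLoopAt G f-joins
      (subst (λ f → IsLoopAt G f w) (sym (only-e f (Joins⇒Incidentʳ G f-joins))) e-loop))

  isComponent-∁⁅w⁆ : IsComponent G (∁ ⁅ w ⁆)
  isComponent-∁⁅w⁆ = (u , x≢y⇒x∈∁⁅y⁆ u≢w) , λ a b a∈ →
    (λ path → x≢y⇒x∈∁⁅y⁆ (Connected-preserves-≢w path (x∈∁⁅y⁆⇒x≢y a∈))) ,
    (λ b∈ → connected-off-w a b (x∈∁⁅y⁆⇒x≢y a∈) (x∈∁⁅y⁆⇒x≢y b∈))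

  r⊤≤n∸1 : r ⊤ ≤ n ∸ 1
  r⊤≤n∸1 = begin
    r ⊤                      ≤⟨ r⊤≤r∁⁅e⁆ M tc 2≤m e ⟩
    r (∁ ⁅ e ⁆)              ≤⟨ r-mono _ _ ∁⁅e⁆⊆E[∁⁅w⁆] ⟩
    r (edgesOf G (∁ ⁅ w ⁆))  ≤⟨ proj₁ fw _ isComponent-∁⁅w⁆ ⟩
    ∣ ∁ ⁅ w ⁆ ∣              ≡⟨ ∣∁⁅x⁆∣≡n∸1 w ⟩
    n ∸ 1                    ∎
    where
    open ℕ.≤-Reasoning
    ∁⁅e⁆⊆E[∁⁅w⁆] : ∁ ⁅ e ⁆ ⊆ edgesOf G (∁ ⁅ w ⁆)
    ∁⁅e⁆⊆E[∁⁅w⁆] {f} f∈ = ∈-edgesOf⁺ G (x≢y⇒x∈∁⁅y⁆ (f≢e ∘ only-e f ∘ inj₁)) (x≢y⇒x∈∁⁅y⁆ (f≢e ∘ only-e f ∘ inj₂))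
      where
      f≢e = x∈∁⁅y⁆⇒x≢y f∈

  G′ : Graph m
  G′ = relabel G (merge u≢w)

  connected′ : IsConnected G′
  connected′ a′ b′ with merge-surjective u≢w a′ | merge-surjective u≢w b′
  ... | a , a≢w , refl | b , b≢w , refl = ConnectedIn-relabel G (merge u≢w) (connected-off-w a b a≢w b≢w)

  -- An edge that avoids v in G can only meet merge v in G′ through w, i.e. it is the loop e.
  Incident′⇒IsLoopAt′ : ∀ {f v} → v ≢ w → ¬ Incident G f v → Incident G′ f (merge u≢w v) → IsLoopAt G′ f (merge u≢w v)
  Incident′⇒IsLoopAt′ {f} {v} v≢w f-avoids-v inc′ with Incident-relabel⁻ G (merge u≢w) inc′
  ... | a , inc , merge-a≡merge-v with a ≟ w
  ...   | no a≢w = contradiction (subst (Incident G f) (merge-injective u≢w a≢w v≢w merge-a≡merge-v) inc) f-avoids-v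
  ...   | yes refl = subst (IsLoopAt G′ f) merge-a≡merge-v
                       (IsLoopAt-relabel G (merge u≢w) (subst (λ f → IsLoopAt G f a) (sym (only-e f inc)) e-loop))

  closure′ : ClosureCondition M G′
  closure′ v′ {f} f∈cl with merge-surjective u≢w v′
  ... | v , v≢w , refl with x∈p∪q⁻ _ _ (proj₁ (proj₂ fw) v (cl-mono M E[G′-v′]⊆E[G-v] f∈cl))
    where
    E[G′-v′]⊆E[G-v] : edgesAvoiding G′ (merge u≢w v) ⊆ edgesAvoiding G v
    E[G′-v′]⊆E[G-v] g∈ = ∈-edgesAvoiding⁺ G (∈-edgesAvoiding⁻ G′ g∈ ∘ Incident-relabel⁺ G (merge u≢w))
  ... | inj₂ f-loop = q⊆p∪q _ _ (∈-loops⁺ G′ (IsLoopAt-relabel G (merge u≢w) (∈-loops⁻ G f-loop)))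
  ... | inj₁ f-avoids with Incident? G′ f (merge u≢w v)
  ...   | no ¬inc′ = p⊆p∪q _ (∈-edgesAvoiding⁺ G′ ¬inc′)
  ...   | yes inc′ = q⊆p∪q _ _ (∈-loops⁺ G′ (Incident′⇒IsLoopAt′ v≢w (∈-edgesAvoiding⁻ G f-avoids) inc′))

  framework′ : IsFramework M G′
  framework′ = IsConnected⇒ComponentRankCondition M G′ connected′ r⊤≤n∸1
             , closure′
             , λ C C-circuit → AtMostTwoComponents-relabel G (merge u≢w) (proj₂ (proj₂ fw) C C-circuit)

loopComponent⇒connectedFramework : ∀ {m} (M : Matroid m) (G : Graph m) → ThreeConnected M → 2 ≤ m →
  IsFramework M G → TwoComponentsOneLoopComponent G → ∃[ G′ ] (IsFramework M G′ × IsConnected G′)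
loopComponent⇒connectedFramework M G tc 2≤m fw (w , e , e-loop , only-e , (u , u≢w) , connected-off-w) =
  G′ , framework′ , connected′
  where open MergeLoopComponent M G tc 2≤m fw e-loop only-e u≢w connected-off-w

lemma4p2 : {m : ℕ} (M : Matroid m) (G : Graph m) →
    ThreeConnected M → 4 ≤ m → IsFramework M G → NoIsolatedVertices G →
    (IsConnected G ⊎ TwoComponentsOneLoopComponent G)
    × (∃[ G′ ] (IsFramework M G′ × IsConnected G′))
lemma4p2 M G tc 4≤m fw niv = shape , connected-framework shape
  where
  open FrameworkComponents M G tc fw niv
  shape : IsConnected G ⊎ TwoComponentsOneLoopComponent G
  shape with Fin.any? (λ v → ∣ ∁ (edges v) ∣ ≤? 1)
  ... | yes (v , ∣∁E∣≤1) with ℕ.m≤n⇒m<n∨m≡n ∣∁E∣≤1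
  ...   | inj₁ ∣∁E∣<1 = inj₁ (∣∁edges∣≡0⇒connected v (ℕ.n<1⇒n≡0 ∣∁E∣<1))
  ...   | inj₂ ∣∁E∣≡1 = inj₂ (∣∁edges∣≡1⇒loopComponent v ∣∁E∣≡1)
  shape | no ∄small-complement = contradiction single-edge (¬single-edge-components 4≤m)
    where
    single-edge : ∀ v → ∣ edges v ∣ ≤ 1
    single-edge v with small-side-edges v
    ... | inj₁ ∣E∣≤1 = ∣E∣≤1
    ... | inj₂ ∣∁E∣≤1 = contradiction (v , ∣∁E∣≤1) ∄small-complement
  connected-framework : IsConnected G ⊎ TwoComponentsOneLoopComponent G → ∃[ G′ ] (IsFramework M G′ × IsConnected G′)
  connected-framework (inj₁ connected) = G , fw , connected
  connected-framework (inj₂ loop-component) =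
    loopComponent⇒connectedFramework M G tc (ℕ.≤-trans (s≤s (s≤s z≤n)) 4≤m) fw loop-component
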